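{- Let $n\ge 2$ and for integers $a,b,c$ put $\operatorname{cap}(n,a,b,c)=n^2-(a+b+c)n+ab+bc+ca$. Then the minimum of $\operatorname{cap}(n,a,b,c)$ over all $a,b,c\in\{1,2,\dots,n-1\}$ is $n-1$, and for $a,b,c\in\{1,\dots,n-1\}$ we have $\operatorname{cap}(n,a,b,c)=n-1$ if and only if $(a,b,c)$ defines a minimum remote brick couple (mRBC).
   Context: A triple $(a,b,c)$ with $a,b,c\in\{1,\dots,n-1\}$ corresponds to a non-degenerate remote brick couple $(T_0,T_3)$ in $\{1,\dots,n\}^3$ with $T_0=I\times J\times K$, $T_3=I^c\times J^c\times K^c$, $|I|=a,|J|=b,|K|=c$; its capacity is $\operatorname{cap}(n,a,b,c)$. A hinge with leaves $T_0,T_3$ has as axis one of the six bricks obtained by taking, in two distinct coordinate directions $i\ne j$, the side of $T_0$ in direction $i$ and the complementary side (of $T_3$) in direction $j$, and the full range $\{1,\dots,n\}$ in the third direction; e.g. $I\times J^c\times\{1,\dots,n\}$. The couple is an mRBC if some hinge with leaves $T_0,T_3$ has an axis consisting of exactly one file (line of $n$ cells), i.e. if there are distinct coordinates $i\ne j$ of $(a,b,c)$ with the $i$-th equal to $1$ and the $j$-th equal to $n-1$. -}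

module Defs where

open import Data.Nat as ℕ using (ℕ; _∸_)
open import Data.Integer using (ℤ; +_; _+_; _-_; _*_)
open import Data.Fin using (Fin)
open import Data.Product using (∃-syntax; _×_)
open import Relation.Binary.PropositionalEquality using (_≡_; _≢_)
open import Relation.Nullary using (¬_)

cap : ℤ → ℤ → ℤ → ℤ → ℤ
cap n a b c = n * n - (a + b + c) * n + (a * b + b * c + c * a)

-- the sizes |I|, |J|, |K| of the sides of T₀ = I × J × K, indexed by coordinate
side : ℕ → ℕ → ℕ → Fin 3 → ℕ
side a b c Fin.zero = a
side a b c (Fin.suc Fin.zero) = b
side a b c (Fin.suc (Fin.suc Fin.zero)) = c

-- number of files (lines of n cells in the third direction) of the hinge axis
-- obtained from the side of T₀ in direction i and the complementary side
-- (of T₃) in direction j, full range in the remaining direction: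
-- |side_i| * (n - |side_j|)
axisFiles : ℕ → ℕ → ℕ → ℕ → Fin 3 → Fin 3 → ℕ
axisFiles n a b c i j = side a b c i ℕ.* (n ∸ side a b c j)

-- (a,b,c) defines an mRBC: some hinge with leaves T₀,T₃ has an axis
-- consisting of exactly one file
IsMRBC : ℕ → ℕ → ℕ → ℕ → Set
IsMRBC n a b c = ∃[ i ] ∃[ j ] (i ≢ j × axisFiles n a b c i j ≡ 1)

InRange : ℕ → ℕ → Set
InRange n a = 1 ℕ.≤ a × a ℕ.< n

-- As a function of c, cap(n,a,b,c) = (n-a)(n-b) + c(a+b-n) is affine, so on
-- 1 ≤ c ≤ n-1 it is smallest at an endpoint: at c = 1 it is
-- (n-1) + (n-1-a)(n-1-b), at c = n-1 it is (n-1) + (a-1)(b-1).  Expanding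
-- around c = 1 when a+b ≥ n and around c = n-1 otherwise writes cap - (n-1)
-- as a sum of two products of non-negative factors.  This vanishes only when
-- a factor of each product does, and in each of the four ways this can happen
-- one side is 1 and another is n-1, which is the mRBC condition.  Conversely
-- cap is symmetric in a, b, c and cap(n,1,n-1,c) = n-1.

module Submission where

open import Defs
open import Data.Nat using (ℕ; _≤_; _∸_)
open import Data.Integer using (+_) renaming (_≤_ to _≤ℤ_)
open import Data.Product using (_×_; ∃-syntax)
open import Relation.Binary.PropositionalEquality using (_≡_)
open import Function.Bundles using (_⇔_)

open import Data.Nat using (suc; s≤s; z≤n; s≤s⁻¹)
open import Data.Nat.Properties
  using (≤-refl; ≤-total; ≤-antisym; n<1+n; m≤m+n; m∸n≡0⇒m≤n; m+n∸n≡m; +-∸-assoc;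
         m+n≡0⇒m≡0; m+n≡0⇒n≡0; m*n≡0⇒m≡0∨n≡0; m*n≡1⇒m≡1; m*n≡1⇒n≡1;
         +-comm; +-identityʳ; *-identityˡ; +-cancelˡ-≡; +-cancelʳ-≡; suc-injective)
open import Data.Integer as ℤ using (1ℤ; +≤+)
import Data.Integer.Properties as ℤₚ
open import Data.Integer.Tactic.RingSolver using (solve-∀)
open import Data.Fin.Patterns using (0F; 1F; 2F)
open import Data.Product using (_,_; uncurry)
import Data.Product as Product
open import Function.Base using (_∘_)
open import Data.Sum as Sum using (_⊎_; inj₁; inj₂)
open import Data.Empty using (⊥-elim)
open import Relation.Binary.PropositionalEquality
  using (refl; sym; trans; cong₂; subst; _≢_; module ≡-Reasoning)
open import Function.Bundles using (mk⇔)

-- The ring solver does not unfold cap, so each identity is proved for the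
-- unfolded polynomial.
module CapIdentities where
  open ℤ using (_+_; _-_; _*_)

  cap-via-c≡1 : ∀ k a b c →
    cap (1ℤ + k) a b c ≡ k + ((k - a) * (k - b) + (c - 1ℤ) * (a + b - (1ℤ + k)))
  cap-via-c≡1 = unfolded
    where
    unfolded : ∀ k a b c → let n = 1ℤ + k in
      n * n - (a + b + c) * n + (a * b + b * c + c * a)
        ≡ k + ((k - a) * (k - b) + (c - 1ℤ) * (a + b - (1ℤ + k)))
    unfolded = solve-∀

  cap-via-c≡k : ∀ k a b c →
    cap (1ℤ + k) a b c ≡ k + ((a - 1ℤ) * (b - 1ℤ) + (k - c) * ((1ℤ + k) - (a + b)))
  cap-via-c≡k = unfolded
    where
    unfolded : ∀ k a b c → let n = 1ℤ + k in
      n * n - (a + b + c) * n + (a * b + b * c + c * a)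
        ≡ k + ((a - 1ℤ) * (b - 1ℤ) + (k - c) * ((1ℤ + k) - (a + b)))
    unfolded = solve-∀

  cap-u-k : ∀ u k c → cap (u + k) u k c ≡ u * k
  cap-u-k = unfolded
    where
    unfolded : ∀ u k c → let n = u + k in
      n * n - (u + k + c) * n + (u * k + k * c + c * u) ≡ u * k
    unfolded = solve-∀

  cap-swap₁₂ : ∀ n a b c → cap n a b c ≡ cap n b a c
  cap-swap₁₂ = unfolded
    where
    unfolded : ∀ n a b c →
      n * n - (a + b + c) * n + (a * b + b * c + c * a)
        ≡ n * n - (b + a + c) * n + (b * a + a * c + c * b)
    unfolded = solve-∀

  cap-swap₂₃ : ∀ n a b c → cap n a b c ≡ cap n a c b
  cap-swap₂₃ = unfolded
    where
    unfolded : ∀ n a b c →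
      n * n - (a + b + c) * n + (a * b + b * c + c * a)
        ≡ n * n - (a + c + b) * n + (a * c + c * b + b * a)
    unfolded = solve-∀

open CapIdentities
open import Data.Nat using (_+_; _*_)

private
  variable
    k a b c : ℕ

inRange⇒≤pred : InRange (suc k) a → a ≤ k
inRange⇒≤pred (_ , a<1+k) = s≤s⁻¹ a<1+k

[+m]-[+n]≡+[m∸n] : ∀ {m n} → n ≤ m → + m ℤ.- + n ≡ + (m ∸ n)
[+m]-[+n]≡+[m∸n] {m} {n} n≤m = trans (ℤₚ.[+m]-[+n]≡m⊖n m n) (ℤₚ.⊖-≥ n≤m)

pos-k+[pq+rs] : ∀ k {P Q R S p q r s} → P ≡ + p → Q ≡ + q → R ≡ + r → S ≡ + s →
  + k ℤ.+ (P ℤ.* Q ℤ.+ R ℤ.* S) ≡ + (k + (p * q + r * s))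
pos-k+[pq+rs] k {p = p} {q} {r} {s} refl refl refl refl =
  cong₂ (λ x y → + k ℤ.+ (x ℤ.+ y)) (sym (ℤₚ.pos-* p q)) (sym (ℤₚ.pos-* r s))

m∸n≡0⇒m≡n : ∀ {m n} → n ≤ m → m ∸ n ≡ 0 → m ≡ n
m∸n≡0⇒m≡n n≤m m∸n≡0 = ≤-antisym (m∸n≡0⇒m≤n m∸n≡0) n≤m

products-vanish : ∀ p q r s → p * q + r * s ≡ 0 → (p ≡ 0 ⊎ q ≡ 0) × (r ≡ 0 ⊎ s ≡ 0)
products-vanish p q r s pq+rs≡0 =
  m*n≡0⇒m≡0∨n≡0 p (m+n≡0⇒m≡0 (p * q) pq+rs≡0) ,
  m*n≡0⇒m≡0∨n≡0 r (m+n≡0⇒n≡0 (p * q) pq+rs≡0)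

m*[1+k∸n]≡1⇒m≡1∧n≡k : ∀ {k m n} → n ≤ k → m * (suc k ∸ n) ≡ 1 → m ≡ 1 × n ≡ k
m*[1+k∸n]≡1⇒m≡1∧n≡k {m = m} n≤k eq =
  m*n≡1⇒m≡1 m _ eq ,
  ≤-antisym n≤k (m∸n≡0⇒m≤n (suc-injective
    (trans (sym (+-∸-assoc 1 n≤k)) (m*n≡1⇒n≡1 m _ eq))))

side≤ : a ≤ k → b ≤ k → c ≤ k → ∀ i → side a b c i ≤ k
side≤ a≤k _   _   0F = a≤k
side≤ _   b≤k _   1F = b≤k
side≤ _   _   c≤k 2F = c≤k

mRBC-intro : ∀ i j → i ≢ j → side a b c i ≡ 1 → side a b c j ≡ k → IsMRBC (suc k) a b c
mRBC-intro {a} {b} {c} {k} i j i≢j sᵢ≡1 sⱼ≡k = i , j , i≢j , (begin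
  side a b c i * (suc k ∸ side a b c j) ≡⟨ cong₂ (λ x y → x * (suc k ∸ y)) sᵢ≡1 sⱼ≡k ⟩
  1 * (suc k ∸ k)                       ≡⟨ *-identityˡ (suc k ∸ k) ⟩
  suc k ∸ k                             ≡⟨ m+n∸n≡m 1 k ⟩
  1                                     ∎)
  where open ≡-Reasoning

mRBC-elim : a ≤ k → b ≤ k → c ≤ k → IsMRBC (suc k) a b c →
  ∃[ i ] ∃[ j ] (i ≢ j × side a b c i ≡ 1 × side a b c j ≡ k)
mRBC-elim a≤k b≤k c≤k (i , j , i≢j , files≡1) =
  i , j , i≢j , m*[1+k∸n]≡1⇒m≡1∧n≡k (side≤ a≤k b≤k c≤k j) files≡1

cap-1-k : cap (+ suc k) (+ 1) (+ k) (+ c) ≡ + k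
cap-1-k {k} {c} = trans (cap-u-k 1ℤ (+ k) (+ c)) (ℤₚ.*-identityˡ (+ k))

mRBC⇒cap≡k : a ≤ k → b ≤ k → c ≤ k → IsMRBC (suc k) a b c →
  cap (+ suc k) (+ a) (+ b) (+ c) ≡ + k
mRBC⇒cap≡k {a} {k} {b} {c} a≤k b≤k c≤k mRBC with mRBC-elim a≤k b≤k c≤k mRBC
... | 0F , 0F , i≢i , _ = ⊥-elim (i≢i refl)
... | 1F , 1F , i≢i , _ = ⊥-elim (i≢i refl)
... | 2F , 2F , i≢i , _ = ⊥-elim (i≢i refl)
... | 0F , 1F , _ , refl , refl = cap-1-k
... | 0F , 2F , _ , refl , refl =
  trans (cap-swap₂₃ (+ suc k) (+ 1) (+ b) (+ k)) cap-1-k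
... | 1F , 0F , _ , refl , refl =
  trans (cap-swap₁₂ (+ suc k) (+ k) (+ 1) (+ c)) cap-1-k
... | 1F , 2F , _ , refl , refl =
  trans (cap-swap₁₂ (+ suc k) (+ a) (+ 1) (+ k))
        (trans (cap-swap₂₃ (+ suc k) (+ 1) (+ a) (+ k)) cap-1-k)
... | 2F , 0F , _ , refl , refl =
  trans (cap-swap₂₃ (+ suc k) (+ k) (+ b) (+ 1))
        (trans (cap-swap₁₂ (+ suc k) (+ k) (+ 1) (+ b)) cap-1-k)
... | 2F , 1F , _ , refl , refl =
  trans (cap-swap₁₂ (+ suc k) (+ a) (+ k) (+ 1))
        (trans (cap-swap₂₃ (+ suc k) (+ k) (+ a) (+ 1))
               (trans (cap-swap₁₂ (+ suc k) (+ k) (+ 1) (+ a)) cap-1-k))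

cap-excess-large : a ≤ k → b ≤ k → 1 ≤ c → suc k ≤ a + b →
  cap (+ suc k) (+ a) (+ b) (+ c) ≡ + (k + ((k ∸ a) * (k ∸ b) + (c ∸ 1) * (a + b ∸ suc k)))
cap-excess-large {a} {k} {b} {c} a≤k b≤k 1≤c 1+k≤a+b =
  trans (cap-via-c≡1 (+ k) (+ a) (+ b) (+ c))
        (pos-k+[pq+rs] k ([+m]-[+n]≡+[m∸n] a≤k) ([+m]-[+n]≡+[m∸n] b≤k)
                         ([+m]-[+n]≡+[m∸n] 1≤c) ([+m]-[+n]≡+[m∸n] 1+k≤a+b))

cap-excess-small : 1 ≤ a → 1 ≤ b → c ≤ k → a + b ≤ suc k →
  cap (+ suc k) (+ a) (+ b) (+ c) ≡ + (k + ((a ∸ 1) * (b ∸ 1) + (k ∸ c) * (suc k ∸ (a + b))))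
cap-excess-small {a} {b} {c} {k} 1≤a 1≤b c≤k a+b≤1+k =
  trans (cap-via-c≡k (+ k) (+ a) (+ b) (+ c))
        (pos-k+[pq+rs] k ([+m]-[+n]≡+[m∸n] 1≤a) ([+m]-[+n]≡+[m∸n] 1≤b)
                         ([+m]-[+n]≡+[m∸n] c≤k) ([+m]-[+n]≡+[m∸n] a+b≤1+k))

large-excess≡0 : a ≤ k → b ≤ k → 1 ≤ c → suc k ≤ a + b →
  (k ∸ a) * (k ∸ b) + (c ∸ 1) * (a + b ∸ suc k) ≡ 0 →
  (a ≡ k ⊎ b ≡ k) × (c ≡ 1 ⊎ a + b ≡ suc k)
large-excess≡0 a≤k b≤k 1≤c 1+k≤a+b excess≡0 =
  Product.map (Sum.map (sym ∘ m∸n≡0⇒m≡n a≤k) (sym ∘ m∸n≡0⇒m≡n b≤k))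
              (Sum.map (m∸n≡0⇒m≡n 1≤c) (m∸n≡0⇒m≡n 1+k≤a+b))
              (products-vanish _ _ _ _ excess≡0)

small-excess≡0 : 1 ≤ a → 1 ≤ b → c ≤ k → a + b ≤ suc k →
  (a ∸ 1) * (b ∸ 1) + (k ∸ c) * (suc k ∸ (a + b)) ≡ 0 →
  (a ≡ 1 ⊎ b ≡ 1) × (c ≡ k ⊎ a + b ≡ suc k)
small-excess≡0 1≤a 1≤b c≤k a+b≤1+k excess≡0 =
  Product.map (Sum.map (m∸n≡0⇒m≡n 1≤a) (m∸n≡0⇒m≡n 1≤b))
              (Sum.map (sym ∘ m∸n≡0⇒m≡n c≤k) (sym ∘ m∸n≡0⇒m≡n a+b≤1+k))
              (products-vanish _ _ _ _ excess≡0)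

mRBC-large : (a ≡ k ⊎ b ≡ k) → (c ≡ 1 ⊎ a + b ≡ suc k) → IsMRBC (suc k) a b c
mRBC-large (inj₁ refl) (inj₁ refl) = mRBC-intro 2F 0F (λ ()) refl refl
mRBC-large (inj₂ refl) (inj₁ refl) = mRBC-intro 2F 1F (λ ()) refl refl
mRBC-large (inj₁ refl) (inj₂ k+b≡1+k) =
  mRBC-intro 1F 0F (λ ()) (+-cancelˡ-≡ _ _ 1 (trans k+b≡1+k (+-comm 1 _))) refl
mRBC-large (inj₂ refl) (inj₂ a+k≡1+k) =
  mRBC-intro 0F 1F (λ ()) (+-cancelʳ-≡ _ _ 1 a+k≡1+k) refl

mRBC-small : (a ≡ 1 ⊎ b ≡ 1) → (c ≡ k ⊎ a + b ≡ suc k) → IsMRBC (suc k) a b c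
mRBC-small (inj₁ refl) (inj₁ refl) = mRBC-intro 0F 2F (λ ()) refl refl
mRBC-small (inj₂ refl) (inj₁ refl) = mRBC-intro 1F 2F (λ ()) refl refl
mRBC-small (inj₁ refl) (inj₂ 1+b≡1+k) =
  mRBC-intro 0F 1F (λ ()) refl (suc-injective 1+b≡1+k)
mRBC-small (inj₂ refl) (inj₂ a+1≡1+k) =
  mRBC-intro 1F 0F (λ ()) refl (+-cancelʳ-≡ 1 _ _ (trans a+1≡1+k (+-comm 1 _)))

cap-excess : InRange (suc k) a → InRange (suc k) b → InRange (suc k) c →
  ∃[ e ] (cap (+ suc k) (+ a) (+ b) (+ c) ≡ + (k + e) × (e ≡ 0 → IsMRBC (suc k) a b c))
cap-excess {k} {a} {b} {c} ra@(1≤a , _) rb@(1≤b , _) rc@(1≤c , _) with ≤-total (suc k) (a + b)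
... | inj₁ 1+k≤a+b =
  _ , cap-excess-large a≤k b≤k 1≤c 1+k≤a+b ,
  uncurry mRBC-large ∘ large-excess≡0 a≤k b≤k 1≤c 1+k≤a+b
  where
  a≤k : a ≤ k
  a≤k = inRange⇒≤pred ra
  b≤k : b ≤ k
  b≤k = inRange⇒≤pred rb
... | inj₂ a+b≤1+k =
  _ , cap-excess-small 1≤a 1≤b c≤k a+b≤1+k ,
  uncurry mRBC-small ∘ small-excess≡0 1≤a 1≤b c≤k a+b≤1+k
  where
  c≤k : c ≤ k
  c≤k = inRange⇒≤pred rc

k≤cap : InRange (suc k) a → InRange (suc k) b → InRange (suc k) c →
  + k ≤ℤ cap (+ suc k) (+ a) (+ b) (+ c)
k≤cap {k} ra rb rc with cap-excess ra rb rc
... | e , cap≡k+e , _ = subst (+ k ≤ℤ_) (sym cap≡k+e) (+≤+ (m≤m+n k e))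

cap≡k⇒mRBC : InRange (suc k) a → InRange (suc k) b → InRange (suc k) c →
  cap (+ suc k) (+ a) (+ b) (+ c) ≡ + k → IsMRBC (suc k) a b c
cap≡k⇒mRBC {k} ra rb rc cap≡k with cap-excess ra rb rc
... | e , cap≡k+e , e≡0⇒mRBC =
  e≡0⇒mRBC (+-cancelˡ-≡ k e 0 (trans (ℤₚ.+-injective (trans (sym cap≡k+e) cap≡k))
                                     (sym (+-identityʳ k))))

mainTheorem2 : (n : ℕ) → 2 ≤ n →
    ((∃[ a ] ∃[ b ] ∃[ c ] (InRange n a × InRange n b × InRange n c
        × cap (+ n) (+ a) (+ b) (+ c) ≡ + (n ∸ 1)))
    × (∀ a b c → InRange n a → InRange n b → InRange n c →
        + (n ∸ 1) ≤ℤ cap (+ n) (+ a) (+ b) (+ c)))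
    × (∀ a b c → InRange n a → InRange n b → InRange n c →
        (cap (+ n) (+ a) (+ b) (+ c) ≡ + (n ∸ 1) ⇔ IsMRBC n a b c))
mainTheorem2 (suc (suc m)) (s≤s (s≤s z≤n)) =
  ( (1 , suc m , 1 , one-inRange , (s≤s z≤n , n<1+n (suc m)) , one-inRange , cap-1-k)
  , (λ _ _ _ → k≤cap) )
  , λ _ _ _ ra rb rc →
      mk⇔ (cap≡k⇒mRBC ra rb rc)
          (mRBC⇒cap≡k (inRange⇒≤pred ra) (inRange⇒≤pred rb) (inRange⇒≤pred rc))
  where
  one-inRange : InRange (suc (suc m)) 1
  one-inRange = ≤-refl , s≤s (s≤s z≤n)
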